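{- For each $i=n,n-1,\dots$, the number of sections in the departure section sequence $\beta_R(v_i)$ is at most one more than the number of sections in the arrival section sequence $\alpha_R(v_i)$.
   Context: A path network has vertices $v_1,\dots,v_n$ left to right, vertex weights $w_i>0$ (evacuees, treated as a continuous fluid), edge $e_i=(v_i,v_{i+1})$ of length $d_i>0$ and capacity $c_i>0$ (maximum flow rate), and travel time $\tau$ per unit distance. Consider evacuation leftward: all evacuees start at time $0$ and move left; evacuees leave a vertex $v_i$ along $e_{i-1}$ at rate at most $c_{i-1}$, queueing at $v_i$ otherwise. $\alpha_R(v_i)$ is the arrival flow-rate profile (as a function of time) at $v_i$ of the evacuees originating at $v_{i+1},\dots,v_n$, and $\beta_R(v_i)$ is the departure flow-rate profile from $v_i$ (toward $v_{i-1}$) of the evacuees originating at $v_i,\dots,v_n$. Such a profile is viewed as a sequence of sections: a section is a maximal time interval on which the flow rate is a constant positive value (its height); an interval of rate $0$ is a gap. -}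

module Defs where

open import Data.Nat as ℕ using (ℕ; zero; suc; _∸_; pred)
open import Data.Rational as ℚ using (ℚ; 0ℚ; _+_; _-_; _*_; _÷_; _<_; _≤_; ≢-nonZero)
open import Data.Rational.Properties using (_≟_; _<?_; _≤?_)
open import Data.Product using (_×_; _,_; proj₁; proj₂)
open import Data.List using (List; []; _∷_; _++_; filter)
open import Relation.Nullary using (yes; no; ¬_; does)
open import Relation.Nullary.Decidable using (⌊_⌋)
open import Data.Bool using (Bool; true; false; if_then_else_)

-- A flow-rate profile (function of time, starting at time 0) is a finite list of
-- consecutive pieces (duration , rate); after the last piece the rate is 0.
Piece : Set
Piece = ℚ × ℚ

Profile : Set
Profile = List Piece

-- division, totalised (only ever used with a nonzero divisor under the hypotheses)
_⊘_ : ℚ → ℚ → ℚ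
x ⊘ y with y ≟ 0ℚ
... | yes _  = 0ℚ
... | no y≢0 = _÷_ x y {{≢-nonZero y≢0}}

min : ℚ → ℚ → ℚ
min a b = if ⌊ a ≤? b ⌋ then a else b

-- Queue dynamics at a vertex with outgoing capacity c:
-- 'run c q α' gives the departure profile when q ≥ 0 evacuees are queued at the
-- start of α and then arrive at the rates given by α.
run : ℚ → ℚ → Profile → Profile
run c q [] with 0ℚ <? q
... | yes _ = (q ⊘ c , c) ∷ []
... | no  _ = []
run c q ((d , a) ∷ α) with 0ℚ <? q
... | no _ with c ≤? a
...   | yes _ = (d , c) ∷ run c ((a - c) * d) α
...   | no  _ = (d , a) ∷ run c 0ℚ α
run c q ((d , a) ∷ α) | yes _ with c ≤? a
...   | yes _ = (d , c) ∷ run c (q + (a - c) * d) α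
...   | no  _ with d ≤? (q ⊘ (c - a))
...     | yes _ = (d , c) ∷ run c (q - (c - a) * d) α
...     | no  _ = (q ⊘ (c - a) , c) ∷ (d - q ⊘ (c - a) , a) ∷ run c 0ℚ α

depart : ℚ → ℚ → Profile → Profile
depart w c α = run c w α

shift : ℚ → Profile → Profile
shift t β = (t , 0ℚ) ∷ β

-- Path network with vertices v₁..vₙ (1-based): w i = weight of vᵢ,
-- d i, c i = length, capacity of eᵢ = (vᵢ , vᵢ₊₁); τ = travel time per unit distance.
-- βk k = β_R(v_{n-k}),  αk k = α_R(v_{n-k}).
module Leftward (τ : ℚ) (w d c : ℕ → ℚ) (n : ℕ) where
  βk : ℕ → Profile
  βk zero    = depart (w n) (c (pred n)) []
  βk (suc k) = depart (w (n ∸ suc k)) (c (pred (n ∸ suc k)))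
                      (shift (τ * d (n ∸ suc k)) (βk k))

  αk : ℕ → Profile
  αk zero    = []
  αk (suc k) = shift (τ * d (n ∸ suc k)) (βk k)

  αR βR : ℕ → Profile
  αR i = αk (n ∸ i)
  βR i = βk (n ∸ i)

-- Number of sections: maximal time intervals of constant positive rate.
countFrom : ℚ → Profile → ℕ
countFrom prev [] = 0
countFrom prev ((_ , r) ∷ β) with 0ℚ <? r | r ≟ prev
... | yes _ | no _ = suc (countFrom r β)
... | _     | _    = countFrom r β

sections : Profile → ℕ
sections β = countFrom 0ℚ (filter (λ p → 0ℚ <? proj₁ p) β)

-- At a vertex of capacity c the departure rate is, at every moment, either c (while a queue
-- exists or arrivals reach c) or the current arrival rate a < c. Hence a departure section
-- that does not start together with an arrival section is a switch between c and some a < c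
-- inside a single arrival section. Switching up to c needs arrivals at rate at least c, i.e.
-- a new arrival section; switching down from c to the current arrival rate p therefore
-- happens at most once per arrival section. Amortising that drop against one unit of
-- credit, held while 0 < p < c, leaves only the section the departures may open at
-- capacity right at time 0 unpaid.
{-# OPTIONS --safe #-}
module Submission where

open import Defs
open import Data.Nat using (ℕ; suc; _≤_)
open import Data.Rational using (ℚ; 0ℚ; _<_)

open import Data.Nat as ℕ using (zero; z≤n; s≤s; pred; _∸_)
import Data.Nat.Properties as ℕ
open import Data.Rational as ℚ using (_-_; _*_; -_; positive)
import Data.Rational.Properties as ℚ
open import Data.Rational.Properties using (_≟_; _<?_; _≤?_)
open import Data.Product using (_×_; _,_; proj₁; uncurry)
open import Data.Sum using (_⊎_; inj₁; inj₂)
open import Data.List using ([]; _∷_)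
open import Data.List.Properties using (filter-all)
open import Data.List.Relation.Unary.All using (All; []; _∷_)
open import Relation.Nullary using (Dec; yes; no)
open import Relation.Binary.PropositionalEquality using (_≡_; _≢_; refl; sym; cong; subst)
open import Data.Empty using (⊥-elim)

*-pos : ∀ {x y} → 0ℚ < x → 0ℚ < y → 0ℚ < x * y
*-pos {x} {y} x>0 y>0 = ℚ.positive⁻¹ _ {{ℚ.pos*pos⇒pos x {{positive x>0}} y {{positive y>0}}}}

⊘-pos : ∀ {x y} → 0ℚ < x → 0ℚ < y → 0ℚ < x ⊘ y
⊘-pos {x} {y} x>0 y>0 with y ≟ 0ℚ
... | yes y≡0 = ⊥-elim (ℚ.<⇒≢ y>0 (sym y≡0))
... | no _    = *-pos x>0 (ℚ.positive⁻¹ _ {{ℚ.1/pos⇒pos y {{positive y>0}}}})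

x<y⇒0<y-x : ∀ {x y} → x < y → 0ℚ < y - x
x<y⇒0<y-x {x} {y} x<y = subst (_< y - x) (ℚ.+-inverseʳ x) (ℚ.+-monoˡ-< (- x) x<y)

newSection : ℚ → ℚ → ℕ
newSection prev r with 0ℚ <? r | r ≟ prev
... | yes _ | no _ = 1
... | _     | _    = 0

countFrom-∷ : ∀ prev d r β → countFrom prev ((d , r) ∷ β) ≡ newSection prev r ℕ.+ countFrom r β
countFrom-∷ prev d r β with 0ℚ <? r | r ≟ prev
... | yes _ | no _  = refl
... | yes _ | yes _ = refl
... | no _  | _     = refl

newSection-self : ∀ r → newSection r r ≡ 0
newSection-self r with 0ℚ <? r | r ≟ r
... | yes _ | no r≢r = ⊥-elim (r≢r refl)
... | yes _ | yes _  = refl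
... | no _  | _      = refl

newSection≤1 : ∀ prev r → newSection prev r ≤ 1
newSection≤1 prev r with 0ℚ <? r | r ≟ prev
... | yes _ | no _  = ℕ.≤-refl
... | yes _ | yes _ = z≤n
... | no _  | _     = z≤n

newSection-pos : ∀ {prev r} → 0ℚ < r → r ≢ prev → newSection prev r ≡ 1
newSection-pos {prev} {r} r>0 r≢prev with 0ℚ <? r | r ≟ prev
... | yes _  | no _       = refl
... | yes _  | yes r≡prev = ⊥-elim (r≢prev r≡prev)
... | no r≯0 | _          = ⊥-elim (r≯0 r>0)

newSection-max : ∀ {prev prev′ r} → r ≢ prev′ → newSection prev r ≤ newSection prev′ r
newSection-max {prev} {prev′} {r} r≢prev′ with 0ℚ <? r | r ≟ prev | r ≟ prev′
... | yes _ | no _  | yes r≡prev′ = ⊥-elim (r≢prev′ r≡prev′)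
... | yes _ | no _  | no _        = ℕ.≤-refl
... | yes _ | yes _ | _           = z≤n
... | no _  | _     | _           = z≤n

newSection-triangle : ∀ p q r → newSection p r ≤ newSection p q ℕ.+ newSection q r
newSection-triangle p q r = by-cases (r ≟ q)
  where
  by-cases : Dec (r ≡ q) → newSection p r ≤ newSection p q ℕ.+ newSection q r
  by-cases (yes refl) = ℕ.m≤m+n _ _
  by-cases (no r≢q)   = ℕ.≤-trans (newSection-max r≢q) (ℕ.m≤n+m _ _)

countFrom-∷-amortise : ∀ {o p e e′ r a} d′ β d α →
  newSection o r ℕ.+ e′ ≤ e ℕ.+ newSection p a →
  countFrom r β ≤ e′ ℕ.+ countFrom a α →
  countFrom o ((d′ , r) ∷ β) ≤ e ℕ.+ countFrom p ((d , a) ∷ α)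
countFrom-∷-amortise {o} {p} {e} {e′} {r} {a} d′ β d α head tail = begin
  countFrom o ((d′ , r) ∷ β)                ≡⟨ countFrom-∷ o d′ r β ⟩
  newSection o r ℕ.+ countFrom r β          ≤⟨ ℕ.+-monoʳ-≤ (newSection o r) tail ⟩
  newSection o r ℕ.+ (e′ ℕ.+ countFrom a α) ≡⟨ ℕ.+-assoc (newSection o r) e′ _ ⟨
  newSection o r ℕ.+ e′ ℕ.+ countFrom a α   ≤⟨ ℕ.+-monoˡ-≤ (countFrom a α) head ⟩
  e ℕ.+ newSection p a ℕ.+ countFrom a α    ≡⟨ ℕ.+-assoc e (newSection p a) _ ⟩
  e ℕ.+ (newSection p a ℕ.+ countFrom a α)  ≡⟨ cong (e ℕ.+_) (countFrom-∷ p d a α) ⟨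
  e ℕ.+ countFrom p ((d , a) ∷ α)           ∎
  where open ℕ.≤-Reasoning

countFrom-∷-monoʳ : ∀ {o r n} d β → countFrom r β ≤ n → countFrom o ((d , r) ∷ β) ≤ newSection o r ℕ.+ n
countFrom-∷-monoʳ {o} {r} d β β≤n =
  ℕ.≤-trans (ℕ.≤-reflexive (countFrom-∷ o d r β)) (ℕ.+-monoʳ-≤ (newSection o r) β≤n)

-- How the queue behaves during the first arrival piece: departures stay at capacity for the
-- whole piece (saturated), there is no queue and arrivals pass through (free), or the queue
-- empties after time x (drain).
data Regime (c q : ℚ) : Profile → Profile → Set where
  idle      : Regime c q [] []
  flush     : 0ℚ < q → Regime c q [] ((q ⊘ c , c) ∷ [])
  saturated : ∀ {d a α} q′ → c ℚ.≤ a ⊎ 0ℚ < q → Regime c q ((d , a) ∷ α) ((d , c) ∷ run c q′ α)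
  free      : ∀ {d a α} → a < c → Regime c q ((d , a) ∷ α) ((d , a) ∷ run c 0ℚ α)
  drain     : ∀ {d a α} x → 0ℚ < q → 0ℚ < x → x < d → a < c →
              Regime c q ((d , a) ∷ α) ((x , c) ∷ (d - x , a) ∷ run c 0ℚ α)

regime : ∀ c q α → Regime c q α (run c q α)
regime c q [] with 0ℚ <? q
... | yes q>0 = flush q>0
... | no _    = idle
regime c q ((d , a) ∷ α) with 0ℚ <? q
... | no _ with c ≤? a
...   | yes c≤a = saturated _ (inj₁ c≤a)
...   | no c≰a  = free (ℚ.≰⇒> c≰a)
regime c q ((d , a) ∷ α) | yes q>0 with c ≤? a
...   | yes c≤a = saturated _ (inj₁ c≤a)
...   | no c≰a with d ≤? (q ⊘ (c - a))
...     | yes _  = saturated _ (inj₂ q>0)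
...     | no d≰x = drain _ q>0 (⊘-pos q>0 (x<y⇒0<y-x (ℚ.≰⇒> c≰a))) (ℚ.≰⇒> d≰x) (ℚ.≰⇒> c≰a)

-- Pays for the drop from c back to the arrival rate p when the queue empties while the
-- arrivals stay at p.
credit : ℚ → ℚ → ℕ
credit c p with 0ℚ <? p | p <? c
... | yes _ | yes _ = 1
... | _     | _     = 0

credit≤newSection : ∀ {c p a} → a ≢ p → credit c a ≤ newSection p a
credit≤newSection {c} {p} {a} a≢p with 0ℚ <? a | a <? c | a ≟ p
... | yes _ | yes _ | no _    = ℕ.≤-refl
... | yes _ | yes _ | yes a≡p = ⊥-elim (a≢p a≡p)
... | yes _ | no _  | _       = z≤n
... | no _  | _     | _       = z≤n

credit-step : ∀ c p a → credit c a ≤ credit c p ℕ.+ newSection p a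
credit-step c p a = by-cases (a ≟ p)
  where
  by-cases : Dec (a ≡ p) → credit c a ≤ credit c p ℕ.+ newSection p a
  by-cases (yes refl) = ℕ.m≤m+n _ _
  by-cases (no a≢p)   = ℕ.≤-trans (credit≤newSection a≢p) (ℕ.m≤n+m _ _)

newSection≤credit : ∀ {c a} → a < c → newSection c a ≤ credit c a
newSection≤credit {c} {a} a<c with 0ℚ <? a | a <? c | a ≟ c
... | yes _ | yes _  | no _  = ℕ.≤-refl
... | yes _ | yes _  | yes _ = z≤n
... | yes _ | no a≮c | _     = ⊥-elim (a≮c a<c)
... | no _  | _      | _     = z≤n

credit-zero : ∀ c → credit c 0ℚ ≡ 0
credit-zero c with 0ℚ <? 0ℚ
... | yes 0<0 = ⊥-elim (ℚ.<-irrefl refl 0<0)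
... | no _    = refl

credit-saturated : ∀ {c a} → c ℚ.≤ a → credit c a ≡ 0
credit-saturated {c} {a} c≤a with 0ℚ <? a | a <? c
... | yes _ | yes a<c = ⊥-elim (ℚ.<-irrefl refl (ℚ.<-≤-trans a<c c≤a))
... | yes _ | no _    = refl
... | no _  | _       = refl

newSection-mono-saturated : ∀ {c p a} → 0ℚ < c → p ℚ.≤ c → c ℚ.≤ a → newSection p c ≤ newSection p a
newSection-mono-saturated {c} {p} {a} c>0 p≤c c≤a = by-cases (c ≟ p)
  where
  by-cases : Dec (c ≡ p) → newSection p c ≤ newSection p a
  by-cases (yes refl) = ℕ.≤-trans (ℕ.≤-reflexive (newSection-self c)) z≤n
  by-cases (no c≢p)   =
    ℕ.≤-trans (newSection≤1 p c) (ℕ.≤-reflexive (sym (newSection-pos (ℚ.<-≤-trans c>0 c≤a) a≢p)))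
    where
    a≢p : a ≢ p
    a≢p refl = c≢p (ℚ.≤-antisym c≤a p≤c)

module _ {c : ℚ} where

  saturated-cost : ∀ o p a →
    newSection o c ℕ.+ (newSection c c ℕ.+ credit c a) ≤ newSection o c ℕ.+ credit c p ℕ.+ newSection p a
  saturated-cost o p a rewrite newSection-self c | ℕ.+-assoc (newSection o c) (credit c p) (newSection p a) =
    ℕ.+-monoʳ-≤ (newSection o c) (credit-step c p a)

  drain-cost : ∀ o p {a} → a < c →
    newSection o c ℕ.+ newSection c a ≤ newSection o c ℕ.+ credit c p ℕ.+ newSection p a
  drain-cost o p {a} a<c rewrite ℕ.+-assoc (newSection o c) (credit c p) (newSection p a) =
    ℕ.+-monoʳ-≤ (newSection o c) (ℕ.≤-trans (newSection≤credit a<c) (credit-step c p a))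

  free-cost : ∀ o p {a} → a < c →
    newSection o a ℕ.+ 0 ≤ newSection o c ℕ.+ credit c p ℕ.+ newSection p a
  free-cost o p {a} a<c rewrite ℕ.+-identityʳ (newSection o a) =
    ℕ.≤-trans (newSection-triangle o c a) (drain-cost o p a<c)

  saturated-cost-unqueued : ∀ {p a} → 0ℚ < c → p ℚ.≤ c → c ℚ.≤ a →
    newSection p c ℕ.+ (newSection c c ℕ.+ credit c a) ≤ newSection p a
  saturated-cost-unqueued {p} c>0 p≤c c≤a
    rewrite newSection-self c | credit-saturated c≤a | ℕ.+-identityʳ (newSection p c) =
    newSection-mono-saturated c>0 p≤c c≤a

module _ {c : ℚ} (c>0 : 0ℚ < c) where

  -- o and p are the rates of the preceding departure and arrival pieces; the term
  -- newSection o c pays for departures that open at capacity at once.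
  mutual
    countFrom-run : ∀ o p q α →
      countFrom o (run c q α) ≤ newSection o c ℕ.+ credit c p ℕ.+ countFrom p α
    countFrom-run o p q [] with run c q [] | regime c q []
    ... | _ | idle    = z≤n
    ... | _ | flush _ =
      ℕ.≤-trans (ℕ.≤-reflexive (countFrom-∷ o (q ⊘ c) c [])) (ℕ.+-monoˡ-≤ 0 (ℕ.m≤m+n _ _))
    countFrom-run o p q ((d , a) ∷ α) with run c q ((d , a) ∷ α) | regime c q ((d , a) ∷ α)
    ... | _ | saturated q′ _ =
      countFrom-∷-amortise d (run c q′ α) d α (saturated-cost o p a) (countFrom-run c a q′ α)
    ... | _ | free a<c =
      countFrom-∷-amortise d (run c 0ℚ α) d α (free-cost o p a<c)
        (countFrom-run-unqueued a α (ℚ.<⇒≤ a<c))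
    ... | _ | drain x _ _ _ a<c =
      countFrom-∷-amortise x ((d - x , a) ∷ run c 0ℚ α) d α (drain-cost o p a<c)
        (countFrom-∷-monoʳ (d - x) (run c 0ℚ α) (countFrom-run-unqueued a α (ℚ.<⇒≤ a<c)))

    countFrom-run-unqueued : ∀ p α → p ℚ.≤ c → countFrom p (run c 0ℚ α) ≤ countFrom p α
    countFrom-run-unqueued p [] p≤c = z≤n
    countFrom-run-unqueued p ((d , a) ∷ α) p≤c with run c 0ℚ ((d , a) ∷ α) | regime c 0ℚ ((d , a) ∷ α)
    ... | _ | saturated q′ (inj₁ c≤a) =
      countFrom-∷-amortise {e = 0} d (run c q′ α) d α (saturated-cost-unqueued c>0 p≤c c≤a)
        (countFrom-run c a q′ α)
    ... | _ | saturated _ (inj₂ 0<0) = ⊥-elim (ℚ.<-irrefl refl 0<0)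
    ... | _ | drain _ 0<0 _ _ _       = ⊥-elim (ℚ.<-irrefl refl 0<0)
    ... | _ | free a<c =
      countFrom-∷-amortise {e = 0} d (run c 0ℚ α) d α (ℕ.≤-reflexive (ℕ.+-identityʳ _))
        (countFrom-run-unqueued a α (ℚ.<⇒≤ a<c))

-- sections discards zero-length pieces; on profiles without them it is countFrom 0ℚ, which
-- is why τ, d and c must be positive.
PositiveDurations : Profile → Set
PositiveDurations = All (λ piece → 0ℚ < proj₁ piece)

sections-positive : ∀ {β} → PositiveDurations β → sections β ≡ countFrom 0ℚ β
sections-positive β>0 = cong (countFrom 0ℚ) (filter-all (λ piece → 0ℚ <? proj₁ piece) β>0)

run-positive : ∀ {c q α} → 0ℚ < c → PositiveDurations α → PositiveDurations (run c q α)
run-positive {c} {q} {[]} c>0 [] with run c q [] | regime c q []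
... | _ | idle      = []
... | _ | flush q>0 = ⊘-pos q>0 c>0 ∷ []
run-positive {c} {q} {(d , a) ∷ α} c>0 (d>0 ∷ α>0) with run c q ((d , a) ∷ α) | regime c q ((d , a) ∷ α)
... | _ | saturated _ _         = d>0 ∷ run-positive c>0 α>0
... | _ | free _                = d>0 ∷ run-positive c>0 α>0
... | _ | drain _ _ x>0 x<d _ = x>0 ∷ x<y⇒0<y-x x<d ∷ run-positive c>0 α>0

sections-run : ∀ {c q α} → 0ℚ < c → PositiveDurations α → sections (run c q α) ≤ suc (sections α)
sections-run {c} {q} {α} c>0 α>0 = begin
  sections (run c q α)                               ≡⟨ sections-positive (run-positive c>0 α>0) ⟩
  countFrom 0ℚ (run c q α)                           ≤⟨ countFrom-run c>0 0ℚ 0ℚ q α ⟩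
  newSection 0ℚ c ℕ.+ credit c 0ℚ ℕ.+ countFrom 0ℚ α ≤⟨ ℕ.+-monoˡ-≤ (countFrom 0ℚ α) initial ⟩
  1 ℕ.+ countFrom 0ℚ α                               ≡⟨ cong suc (sections-positive α>0) ⟨
  suc (sections α)                                   ∎
  where
  open ℕ.≤-Reasoning
  initial : newSection 0ℚ c ℕ.+ credit c 0ℚ ≤ 1
  initial rewrite credit-zero c | ℕ.+-identityʳ (newSection 0ℚ c) = newSection≤1 0ℚ c

edge-index : ∀ {n k} → 2 ℕ.+ k ≤ n → 1 ≤ n ∸ suc k × suc (n ∸ suc k) ≤ n
edge-index h = ℕ.m+n≤o⇒m≤o∸n 1 h , ℕ.∸-monoʳ-< (s≤s z≤n) (ℕ.m+n≤o⇒n≤o 1 h)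

module LeftwardSections (τ : ℚ) (w d c : ℕ → ℚ) (n : ℕ) (τ>0 : 0ℚ < τ)
    (d>0 : ∀ i → 1 ≤ i → suc i ≤ n → 0ℚ < d i)
    (c>0 : ∀ i → 1 ≤ i → suc i ≤ n → 0ℚ < c i) where
  open Leftward τ w d c n

  capacity-pos : ∀ k → 2 ℕ.+ k ≤ n → 0ℚ < c (pred (n ∸ k))
  capacity-pos k h = subst (λ i → 0ℚ < c i) (sym (ℕ.pred[m∸n]≡m∸[1+n] n k)) (uncurry (c>0 _) (edge-index h))

  delay-pos : ∀ k → 2 ℕ.+ k ≤ n → 0ℚ < τ * d (n ∸ suc k)
  delay-pos k h = *-pos τ>0 (uncurry (d>0 _) (edge-index h))

  βk-run : ∀ k → βk k ≡ run (c (pred (n ∸ k))) (w (n ∸ k)) (αk k)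
  βk-run zero    = refl
  βk-run (suc k) = refl

  arrivals-positive : ∀ k → suc k ≤ n → PositiveDurations (αk k)
  arrivals-positive zero    _ = []
  arrivals-positive (suc k) h =
    delay-pos k h ∷ subst PositiveDurations (sym (βk-run k))
                      (run-positive (capacity-pos k h) (arrivals-positive k (ℕ.≤-trans (ℕ.n≤1+n _) h)))

  sections-βk : ∀ k → 2 ℕ.+ k ≤ n → sections (βk k) ≤ suc (sections (αk k))
  sections-βk k h rewrite βk-run k =
    sections-run (capacity-pos k h) (arrivals-positive k (ℕ.≤-trans (ℕ.n≤1+n _) h))

proposition2 : (τ : ℚ) (w d c : ℕ → ℚ) (n : ℕ) →
    0ℚ < τ →
    (∀ i → 1 ≤ i → i ≤ n → 0ℚ < w i) →
    (∀ i → 1 ≤ i → suc i ≤ n → 0ℚ < d i) →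
    (∀ i → 1 ≤ i → suc i ≤ n → 0ℚ < c i) →
    ∀ i → 2 ≤ i → i ≤ n →
    sections (Leftward.βR τ w d c n i) ≤ suc (sections (Leftward.αR τ w d c n i))
proposition2 τ w d c n τ>0 _ d>0 c>0 i 2≤i i≤n =
  LeftwardSections.sections-βk τ w d c n τ>0 d>0 c>0 (n ∸ i) 2+[n∸i]≤n
  where
  2+[n∸i]≤n : 2 ℕ.+ (n ∸ i) ≤ n
  2+[n∸i]≤n = ℕ.≤-trans (ℕ.+-monoˡ-≤ (n ∸ i) 2≤i) (ℕ.≤-reflexive (ℕ.m+[n∸m]≡n i≤n))
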